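{- Let $r$ be a positive integer and let $P$ be a $0-1$ matrix with $r$ rows which contains $P_{r,2}$. Then for every fixed integer $k \ge r$, $ex_k(m,P) = \Theta(m^r)$ as $m\to\infty$ (with constants depending on $P$ and $k$).
   Context: $P_{r,c}$ denotes the $r\times c$ matrix all of whose entries are one. A $0-1$ matrix $A$ contains a $0-1$ matrix $M$ if some submatrix of $A$ can be transformed into $M$ by changing some ones to zeroes; otherwise $A$ avoids $M$. $ex_k(m,P)$ is the maximum number of columns in a $0-1$ matrix with $m$ rows that avoids $P$ and has at least $k$ ones in every column. -}

module Defs where

open import Data.Nat using (ℕ; zero; suc; _+_; _*_; _^_; _≤_; _<_; _≥_)
open import Data.Fin using (Fin; toℕ) renaming (_<_ to _<ᶠ_)
open import Data.Bool using (Bool; true; false; if_then_else_)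
open import Data.List using (List; map; allFin)
open import Data.Nat.ListAction using (sum)
open import Data.Product using (Σ; ∃; _×_; _,_)
open import Relation.Binary.PropositionalEquality using (_≡_)
open import Relation.Nullary using (¬_)

Matrix : ℕ → ℕ → Set
Matrix m n = Fin m → Fin n → Bool

Increasing : ∀ {a b} → (Fin a → Fin b) → Set
Increasing {a} f = ∀ (i j : Fin a) → i <ᶠ j → f i <ᶠ f j

-- A contains M: some submatrix of A (rows f, columns g) can be turned into M
-- by changing some ones to zeroes, i.e. every one of M sits on a one of A.
Contains : ∀ {m n r c} → Matrix m n → Matrix r c → Set
Contains {m} {n} {r} {c} A M =
  Σ (Fin r → Fin m) λ f → Σ (Fin c → Fin n) λ g →
    Increasing f × Increasing g ×
    (∀ (i : Fin r) (j : Fin c) → M i j ≡ true → A (f i) (g j) ≡ true)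

Avoids : ∀ {m n r c} → Matrix m n → Matrix r c → Set
Avoids A M = ¬ Contains A M

allOnes : (r c : ℕ) → Matrix r c
allOnes r c i j = true

onesInColumn : ∀ {m n} → Matrix m n → Fin n → ℕ
onesInColumn {m} A j = sum (map (λ i → if A i j then 1 else 0) (allFin m))

Admissible : ∀ {m n r c} → ℕ → Matrix r c → Matrix m n → Set
Admissible {n = n} k P A = Avoids A P × (∀ (j : Fin n) → k ≤ onesInColumn A j)

-- ex_k(m,P) = Θ(m^r) as m → ∞, phrased without assuming the maximum exists:
-- there are positive constants d, C and a threshold M₀ such that for all m ≥ M₀
--  * (lower bound) some admissible m-row matrix has n columns with n * d ≥ m^r
--    (i.e. ex_k(m,P) ≥ m^r / d), and
--  * (upper bound) every admissible m-row matrix has n ≤ C * m^r columns.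
ExTheta : ∀ {r c} → ℕ → Matrix r c → Set
ExTheta {r} k P =
  Σ ℕ λ d → Σ ℕ λ C → Σ ℕ λ M₀ →
    1 ≤ d × 1 ≤ C ×
    (∀ (m : ℕ) → M₀ ≤ m →
      (Σ ℕ λ n → Σ (Matrix m n) λ A → Admissible k P A × m ^ r ≤ n * d)
      × (∀ (n : ℕ) (A : Matrix m n) → Admissible k P A → n ≤ C * m ^ r))

-- Every column of an admissible matrix has at
-- least k ≥ r ones, so we may fix an increasing r-tuple of its one-rows; such
-- a tuple is one of m^r values.  With more than t·m^r columns, t+1 columns
-- share a tuple and form a copy of P_{r,t+1}, which contains every r × (t+1)
-- matrix, in particular P.
--
-- Column j is the polynomial f_j of
-- degree < r whose coefficients are the base-q digits of j.  Rows are cut into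
-- blocks of B = q·k^r rows, and column j has a one at offset f_j(x) of block x
-- for each x < k.  Two such polynomials agreeing at r points are equal (factor
-- theorem over ℤ, then uniqueness of base-q digits), so two columns never share
-- r one-rows and the matrix avoids P_{r,2}, hence P.  Taking q = m / k^{r+1}
-- gives q^r ≥ m^r / (2k^{r+1})^r columns.
module Submission where

open import Defs
open import Data.Nat using (ℕ; _≤_)

open import Data.Nat using (zero; suc; _+_; _*_; _^_; _<_; z≤n; s≤s; NonZero; >-nonZero; >-nonZero⁻¹; _≟_; _<?_; _≤?_)
open import Data.Nat.Properties
open import Data.Nat.DivMod using (_/_; _%_; m≡m%n+[m/n]*n; [m+kn]%n≡m%n; m<n⇒m%n≡m; m%n<n; m%n≤n; m/n*n≤m; m≥n⇒m/n>0)
open import Data.Nat.ListAction using (sum)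
open import Data.Fin as Fin using (Fin; toℕ; fromℕ<; inject≤; funToFin; finToFun) renaming (_<_ to _<ᶠ_)
import Data.Fin.Properties as FinP
open import Data.Bool using (Bool; true; false; if_then_else_)
import Data.Bool as Bool
open import Data.List using (List; []; _∷_; map; allFin; filter; length; lookup)
open import Data.List.Properties using (length-tabulate)
open import Data.List.Relation.Unary.Any using (here; index)
open import Data.List.Relation.Unary.Any.Properties using (lookup-index)
import Data.List.Relation.Unary.All as All
open import Data.List.Relation.Unary.AllPairs using (AllPairs; _∷_)
import Data.List.Relation.Unary.AllPairs.Properties as AllPairs
open import Data.List.Membership.Propositional using (_∈_)
open import Data.List.Membership.Propositional.Properties using (∈-filter⁺; ∈-filter⁻; ∈-allFin; ∈-lookup)
import Data.List.Relation.Binary.Sublist.Propositional.Properties as Sublist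
open import Data.Product using (Σ; ∃-syntax; _×_; _,_; proj₁; proj₂)
open import Data.Empty using (⊥-elim)
open import Function using (_∘_)
open import Function.Definitions using (Injective)
open import Relation.Nullary using (Dec; yes; no; does; ¬?)
open import Relation.Nullary.Decidable using (dec-true)
open import Relation.Unary using (Decidable)
open import Relation.Binary.Definitions using (tri<; tri≈; tri>)
open import Relation.Binary.PropositionalEquality
open import Algebra.Properties.CommutativeSemigroup *-commutativeSemigroup using (x∙yz≈y∙xz)

does-true : ∀ {p} {P : Set p} (P? : Dec P) → does P? ≡ true → P
does-true (yes p) _ = p

contains-trans : ∀ {m n r c r′ c′} {A : Matrix m n} {B : Matrix r c} {M : Matrix r′ c′} →
  Contains A B → Contains B M → Contains A M
contains-trans (f , g , f↑ , g↑ , A⊇B) (f′ , g′ , f′↑ , g′↑ , B⊇M) =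
  f ∘ f′ , g ∘ g′ ,
  (λ i j i<j → f↑ _ _ (f′↑ i j i<j)) , (λ i j i<j → g↑ _ _ (g′↑ i j i<j)) ,
  λ i j Mij → A⊇B _ _ (B⊇M i j Mij)

allOnes-contains : ∀ {r c} (P : Matrix r c) → Contains (allOnes r c) P
allOnes-contains P = (λ i → i) , (λ j → j) , (λ _ _ i<j → i<j) , (λ _ _ i<j → i<j) , λ _ _ _ → refl

increasing-injective : ∀ {a b} {f : Fin a → Fin b} → Increasing f → Injective _≡_ _≡_ f
increasing-injective f↑ {i} {j} fi≡fj with FinP.<-cmp i j
... | tri< i<j _ _ = ⊥-elim (FinP.<-irrefl fi≡fj (f↑ i j i<j))
... | tri≈ _ i≡j _ = i≡j
... | tri> _ _ j<i = ⊥-elim (FinP.<-irrefl (sym fi≡fj) (f↑ j i j<i))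

lookup-increasing : ∀ {n} {xs : List (Fin n)} → AllPairs _<ᶠ_ xs →
  ∀ i j → i <ᶠ j → lookup xs i <ᶠ lookup xs j
lookup-increasing (x<xs ∷ _) Fin.zero (Fin.suc j) _ = All.lookup x<xs (∈-lookup j)
lookup-increasing (_ ∷ sorted) (Fin.suc i) (Fin.suc j) (s≤s i<j) = lookup-increasing sorted i j i<j

select : ∀ {n s} {xs : List (Fin n)} → AllPairs _<ᶠ_ xs → s ≤ length xs →
  Σ (Fin s → Fin n) λ g → Increasing g × (∀ i → g i ∈ xs)
select {xs = xs} sorted s≤len =
  (λ i → lookup xs (position i)) ,
  (λ i j i<j → lookup-increasing sorted (position i) (position j) (position-increasing i j i<j)) ,
  (λ i → ∈-lookup (position i))
  where
  position : Fin _ → Fin (length xs)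
  position i = inject≤ i s≤len
  position-increasing : Increasing position
  position-increasing i j i<j =
    subst₂ _<_ (sym (FinP.toℕ-inject≤ i s≤len)) (sym (FinP.toℕ-inject≤ j s≤len)) i<j

onesOf : ∀ {m n} → Matrix m n → Fin n → List (Fin m)
onesOf {m} A j = filter (λ i → A i j Bool.≟ true) (allFin m)

onesOf-sorted : ∀ {m n} (A : Matrix m n) j → AllPairs _<ᶠ_ (onesOf A j)
onesOf-sorted A j = AllPairs.filter⁺ _ (AllPairs.tabulate⁺-< (λ i<j → i<j))

onesOf-one : ∀ {m n} (A : Matrix m n) j {i} → i ∈ onesOf A j → A i j ≡ true
onesOf-one {m} A j i∈ = proj₂ (∈-filter⁻ (λ i → A i j Bool.≟ true) {xs = allFin m} i∈)

sum-indicator : ∀ {a} {X : Set a} (b : X → Bool) (xs : List X) →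
  sum (map (λ x → if b x then 1 else 0) xs) ≡ length (filter (λ x → b x Bool.≟ true) xs)
sum-indicator b [] = refl
sum-indicator b (x ∷ xs) with b x
... | true = cong suc (sum-indicator b xs)
... | false = sum-indicator b xs

onesInColumn≡length : ∀ {m n} (A : Matrix m n) j → onesInColumn A j ≡ length (onesOf A j)
onesInColumn≡length {m} A j = sum-indicator (λ i → A i j) (allFin m)

injection⇒ones : ∀ {m n k} (A : Matrix m n) j (e : Fin k → Fin m) → Injective _≡_ _≡_ e →
  (∀ x → A (e x) j ≡ true) → k ≤ onesInColumn A j
injection⇒ones {m} {k = k} A j e e-injective e-one =
  subst (k ≤_) (sym (onesInColumn≡length A j)) (FinP.injective⇒≤ place-injective)
  where
  e∈ : ∀ x → e x ∈ onesOf A j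
  e∈ x = ∈-filter⁺ (λ i → A i j Bool.≟ true) (∈-allFin (e x)) (e-one x)
  place : Fin k → Fin (length (onesOf A j))
  place x = index (e∈ x)
  place-injective : Injective _≡_ _≡_ place
  place-injective {x} {y} same = e-injective (begin
    e x                         ≡⟨ lookup-index (e∈ x) ⟩
    lookup (onesOf A j) (place x) ≡⟨ cong (lookup (onesOf A j)) same ⟩
    lookup (onesOf A j) (place y) ≡⟨ lookup-index (e∈ y) ⟨
    e y                         ∎)
    where open ≡-Reasoning

length-filter-split : ∀ {a p} {X : Set a} {P : X → Set p} (P? : Decidable P) (xs : List X) →
  length (filter P? xs) + length (filter (¬? ∘ P?) xs) ≡ length xs
length-filter-split P? [] = refl
length-filter-split P? (x ∷ xs) with P? x
... | yes _ = cong suc (length-filter-split P? xs)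
... | no _ = trans (+-suc _ _) (cong suc (length-filter-split P? xs))

fibre : ∀ {a} {X : Set a} → (X → ℕ) → ℕ → List X → List X
fibre κ v = filter (λ x → κ x ≟ v)

-- By induction on M:
-- if the fibre of the top key M−1 is small, the remaining elements still
-- number more than t·(M−1).
pigeonhole : ∀ {a} {X : Set a} (κ : X → ℕ) M t (xs : List X) →
  (∀ {x} → x ∈ xs → κ x < M) → t * M < length xs → ∃[ v ] t < length (fibre κ v xs)
pigeonhole κ zero t [] _ many = ⊥-elim (n≮0 (subst (_< 0) (*-zeroʳ t) many))
pigeonhole κ zero t (x ∷ _) bounded _ = ⊥-elim (n≮0 (bounded (here refl)))
pigeonhole κ (suc M) t xs bounded many with t <? length (fibre κ M xs)
... | yes top-large = M , top-large
... | no top-small =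
  let v , rest-fibre-large = pigeonhole κ M t rest rest-bounded rest-many
  in v , <-≤-trans rest-fibre-large fibre-of-rest
  where
  isTop? : Decidable (λ x → κ x ≡ M)
  isTop? x = κ x ≟ M
  rest : List _
  rest = filter (¬? ∘ isTop?) xs
  rest-bounded : ∀ {x} → x ∈ rest → κ x < M
  rest-bounded x∈ with ∈-filter⁻ (¬? ∘ isTop?) {xs = xs} x∈
  ... | x∈xs , not-top = ≤∧≢⇒< (≤-pred (bounded x∈xs)) not-top
  rest-many : t * M < length rest
  rest-many = +-cancelˡ-< t (t * M) (length rest) (begin-strict
    t + t * M                            ≡⟨ *-suc t M ⟨
    t * suc M                            <⟨ many ⟩
    length xs                            ≡⟨ length-filter-split isTop? xs ⟨
    length (fibre κ M xs) + length rest  ≤⟨ +-monoˡ-≤ (length rest) (≮⇒≥ top-small) ⟩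
    t + length rest                      ∎)
    where open ≤-Reasoning
  fibre-of-rest : ∀ {v} → length (fibre κ v rest) ≤ length (fibre κ v xs)
  fibre-of-rest {v} = Sublist.length-mono-≤
    (Sublist.filter⁺ (λ x → κ x ≟ v) (λ x → κ x ≟ v) (λ { refl κx≡v → κx≡v }) (Sublist.filter-⊆ (¬? ∘ isTop?) xs))

module ColumnTuples {m n r} (A : Matrix m n) (r≤ones : ∀ j → r ≤ onesInColumn A j) where

  tuple : ∀ j → Σ (Fin r → Fin m) λ f → Increasing f × (∀ i → f i ∈ onesOf A j)
  tuple j = select (onesOf-sorted A j) (subst (r ≤_) (onesInColumn≡length A j) (r≤ones j))

  rowsOf : Fin n → Fin r → Fin m
  rowsOf j = proj₁ (tuple j)

  key : Fin n → ℕ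
  key j = toℕ (funToFin (rowsOf j))

  same-key⇒ones : ∀ {j j′} → key j ≡ key j′ → ∀ i → A (rowsOf j i) j′ ≡ true
  same-key⇒ones {j} {j′} same i =
    subst (λ row → A row j′ ≡ true) same-row (onesOf-one A j′ (proj₂ (proj₂ (tuple j′)) i))
    where
    open ≡-Reasoning
    same-row : rowsOf j′ i ≡ rowsOf j i
    same-row = begin
      rowsOf j′ i                         ≡⟨ FinP.finToFun-funToFin (rowsOf j′) i ⟨
      finToFun (funToFin (rowsOf j′)) i  ≡⟨ cong (λ code → finToFun code i) (FinP.toℕ-injective same) ⟨
      finToFun (funToFin (rowsOf j)) i   ≡⟨ FinP.finToFun-funToFin (rowsOf j) i ⟩
      rowsOf j i                          ∎

  -- More than t·m^r columns force a copy of P_{r,t+1}: t+1 columns share a key.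
  many-columns⇒allOnes : ∀ t → t * m ^ r < n → Contains A (allOnes r (suc t))
  many-columns⇒allOnes t many =
    let v , fibre-large = pigeonhole key (m ^ r) t (allFin n)
                            (λ {j} _ → FinP.toℕ<n (funToFin (rowsOf j)))
                            (subst (t * m ^ r <_) (sym (length-tabulate (λ j → j))) many)
        g , g↑ , g∈fibre = select (AllPairs.filter⁺ _ (AllPairs.tabulate⁺-< (λ i<j → i<j))) fibre-large
        key-of : ∀ j → key (g j) ≡ v
        key-of j = proj₂ (∈-filter⁻ (λ j → key j ≟ v) {xs = allFin n} (g∈fibre j))
    in rowsOf (g Fin.zero) , g , proj₁ (proj₂ (tuple (g Fin.zero))) , g↑ ,
       λ i j _ → same-key⇒ones (trans (key-of Fin.zero) (sym (key-of j))) i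

upper-bound : ∀ {m n r t} (k : ℕ) (P : Matrix r (suc t)) (A : Matrix m n) → r ≤ k →
  Admissible k P A → n ≤ t * m ^ r
upper-bound {m} {n} {r} {t} k P A r≤k (avoids , k≤ones) with n ≤? t * m ^ r
... | yes few = few
... | no n≰ = ⊥-elim (avoids (contains-trans {A = A} (ColumnTuples.many-columns⇒allOnes A r≤ones t (≰⇒> n≰))
                                             (allOnes-contains P)))
  where
  r≤ones : ∀ j → r ≤ onesInColumn A j
  r≤ones j = ≤-trans r≤k (k≤ones j)

evalℕ : ∀ {d} → (Fin d → ℕ) → ℕ → ℕ
evalℕ {zero} a x = 0
evalℕ {suc d} a x = a Fin.zero + evalℕ (a ∘ Fin.suc) x * x

module IntegerPolynomials where
  open import Data.Integer using (ℤ; +_; 0ℤ; _-_) renaming (_+_ to _⊕_; _*_ to _⊛_)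
  import Data.Integer.Properties as ℤP
  open import Data.Integer.Solver using (module +-*-Solver)
  open +-*-Solver
  open import Data.Vec.Functional using () renaming (_∷_ to _◂_)
  open import Data.Sum using (inj₁; inj₂)
  open ≡-Reasoning

  eval : ∀ {d} → (Fin d → ℤ) → ℤ → ℤ
  eval {zero} c x = 0ℤ
  eval {suc d} c x = c Fin.zero ⊕ eval (c ∘ Fin.suc) x ⊛ x

  divide : ∀ {d} (c : Fin (suc d) → ℤ) (a : ℤ) →
    Σ (Fin d → ℤ) λ c′ → ∀ x → eval c x ≡ eval c a ⊕ eval c′ x ⊛ (x - a)
  divide {zero} c a = (λ ()) , λ x →
    solve 3 (λ c₀ x a → c₀ :+ con 0ℤ :* x := (c₀ :+ con 0ℤ :* a) :+ con 0ℤ :* (x :- a)) refl (c Fin.zero) x a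
  divide {suc d} c a with divide (c ∘ Fin.suc) a
  ... | c″ , split = (h a ◂ c″) , λ x → begin
      c Fin.zero ⊕ h x ⊛ x                          ≡⟨ cong (λ y → c Fin.zero ⊕ y ⊛ x) (split x) ⟩
      c Fin.zero ⊕ (h a ⊕ eval c″ x ⊛ (x - a)) ⊛ x  ≡⟨ regroup (c Fin.zero) x a (h a) (eval c″ x) ⟩
      (c Fin.zero ⊕ h a ⊛ a) ⊕ (h a ⊕ eval c″ x ⊛ x) ⊛ (x - a) ∎
    where
    h : ℤ → ℤ
    h = eval (c ∘ Fin.suc)
    regroup : ∀ c₀ x a ha q → c₀ ⊕ (ha ⊕ q ⊛ (x - a)) ⊛ x ≡ (c₀ ⊕ ha ⊛ a) ⊕ (ha ⊕ q ⊛ x) ⊛ (x - a)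
    regroup = solve 5 (λ c₀ x a ha q →
      c₀ :+ (ha :+ q :* (x :- a)) :* x := (c₀ :+ ha :* a) :+ (ha :+ q :* x) :* (x :- a)) refl

  -- A polynomial of degree < d with d distinct roots vanishes everywhere:
  -- divide out the first root; the quotient keeps the other d − 1 roots.
  roots⇒zero : ∀ {d} (c : Fin d → ℤ) (p : Fin d → ℤ) → Injective _≡_ _≡_ p →
    (∀ i → eval c (p i) ≡ 0ℤ) → ∀ x → eval c x ≡ 0ℤ
  roots⇒zero {zero} c p _ _ x = refl
  roots⇒zero {suc d} c p p-injective root x with divide c (p Fin.zero)
  ... | c′ , split = begin
      eval c x                                         ≡⟨ split x ⟩
      eval c (p Fin.zero) ⊕ eval c′ x ⊛ (x - p Fin.zero) ≡⟨ cong₂ (λ u v → u ⊕ v ⊛ (x - p Fin.zero)) (root Fin.zero) quotient-zero ⟩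
      0ℤ ⊕ 0ℤ ⊛ (x - p Fin.zero)                       ≡⟨ ℤP.*-zeroˡ (x - p Fin.zero) ⟩
      0ℤ                                               ∎
    where
    quotient-root : ∀ i → eval c′ (p (Fin.suc i)) ≡ 0ℤ
    quotient-root i with ℤP.i*j≡0⇒i≡0∨j≡0 (eval c′ (p (Fin.suc i))) product-zero
      where
      product-zero : eval c′ (p (Fin.suc i)) ⊛ (p (Fin.suc i) - p Fin.zero) ≡ 0ℤ
      product-zero = begin
        eval c′ (p (Fin.suc i)) ⊛ (p (Fin.suc i) - p Fin.zero)          ≡⟨ ℤP.+-identityˡ _ ⟨
        0ℤ ⊕ eval c′ (p (Fin.suc i)) ⊛ (p (Fin.suc i) - p Fin.zero)    ≡⟨ cong (λ u → u ⊕ _) (root Fin.zero) ⟨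
        eval c (p Fin.zero) ⊕ eval c′ (p (Fin.suc i)) ⊛ (p (Fin.suc i) - p Fin.zero) ≡⟨ split (p (Fin.suc i)) ⟨
        eval c (p (Fin.suc i))                                        ≡⟨ root (Fin.suc i) ⟩
        0ℤ                                                            ∎
    ... | inj₁ quotient-vanishes = quotient-vanishes
    ... | inj₂ distance-zero with p-injective (ℤP.i-j≡0⇒i≡j _ _ distance-zero)
    ...   | ()
    quotient-zero : eval c′ x ≡ 0ℤ
    quotient-zero = roots⇒zero c′ (p ∘ Fin.suc) (FinP.suc-injective ∘ p-injective) quotient-root x

  eval-difference : ∀ {d} (a b : Fin d → ℕ) x →
    eval (λ i → + a i - + b i) (+ x) ≡ + evalℕ a x - + evalℕ b x
  eval-difference {zero} a b x = refl
  eval-difference {suc d} a b x = begin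
      (+ a₀ - + b₀) ⊕ eval (λ i → + a (Fin.suc i) - + b (Fin.suc i)) (+ x) ⊛ + x
        ≡⟨ cong (λ y → (+ a₀ - + b₀) ⊕ y ⊛ + x) (eval-difference (a ∘ Fin.suc) (b ∘ Fin.suc) x) ⟩
      (+ a₀ - + b₀) ⊕ (+ A - + B) ⊛ + x
        ≡⟨ solve 5 (λ a₀ b₀ A B x → (a₀ :- b₀) :+ (A :- B) :* x := (a₀ :+ A :* x) :- (b₀ :+ B :* x)) refl (+ a₀) (+ b₀) (+ A) (+ B) (+ x) ⟩
      (+ a₀ ⊕ + A ⊛ + x) - (+ b₀ ⊕ + B ⊛ + x)
        ≡⟨ cong₂ _-_ (lift a₀ A) (lift b₀ B) ⟨
      + (a₀ + A * x) - + (b₀ + B * x) ∎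
    where
    a₀ b₀ A B : ℕ
    a₀ = a Fin.zero
    b₀ = b Fin.zero
    A = evalℕ (a ∘ Fin.suc) x
    B = evalℕ (b ∘ Fin.suc) x
    lift : ∀ u v → + (u + v * x) ≡ + u ⊕ + v ⊛ + x
    lift u v = trans (ℤP.pos-+ u (v * x)) (cong (+ u ⊕_) (ℤP.pos-* v x))

  agree⇒equal : ∀ {d} (a b : Fin d → ℕ) (p : Fin d → ℕ) → Injective _≡_ _≡_ p →
    (∀ i → evalℕ a (p i) ≡ evalℕ b (p i)) → ∀ x → evalℕ a x ≡ evalℕ b x
  agree⇒equal a b p p-injective agree x =
    ℤP.+-injective (ℤP.i-j≡0⇒i≡j _ _ (trans (sym (eval-difference a b x))
      (roots⇒zero (λ i → + a i - + b i) (+_ ∘ p) (p-injective ∘ ℤP.+-injective) difference-root (+ x))))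
    where
    difference-root : ∀ i → eval (λ i → + a i - + b i) (+ p i) ≡ 0ℤ
    difference-root i = trans (eval-difference a b (p i)) (ℤP.i≡j⇒i-j≡0 (cong +_ (agree i)))

open IntegerPolynomials using (agree⇒equal)

divmod-unique : ∀ {x a b A B} → a < x → b < x → a + A * x ≡ b + B * x → a ≡ b × A ≡ B
divmod-unique {x} {a} {b} {A} {B} a<x b<x same = a≡b , A≡B
  where
  instance
    x≢0 : NonZero x
    x≢0 = >-nonZero (≤-<-trans z≤n a<x)
  remainder : ∀ {c} C → c < x → (c + C * x) % x ≡ c
  remainder {c} C c<x = trans ([m+kn]%n≡m%n c C x) (m<n⇒m%n≡m c<x)
  a≡b : a ≡ b
  a≡b = trans (sym (remainder A a<x)) (trans (cong (_% x) same) (remainder B b<x))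
  A≡B : A ≡ B
  A≡B = *-cancelʳ-≡ A B x (+-cancelˡ-≡ a (A * x) (B * x) (trans same (cong (_+ B * x) (sym a≡b))))

digits-unique : ∀ {d} (a b : Fin d → ℕ) x → (∀ i → a i < x) → (∀ i → b i < x) →
  evalℕ a x ≡ evalℕ b x → ∀ i → a i ≡ b i
digits-unique {suc d} a b x a<x b<x same i
  with divmod-unique {A = evalℕ (a ∘ Fin.suc) x} {B = evalℕ (b ∘ Fin.suc) x} (a<x Fin.zero) (b<x Fin.zero) same
digits-unique {suc d} a b x a<x b<x same Fin.zero | a₀≡b₀ , _ = a₀≡b₀
digits-unique {suc d} a b x a<x b<x same (Fin.suc i) | _ , rest-same =
  digits-unique (a ∘ Fin.suc) (b ∘ Fin.suc) x (a<x ∘ Fin.suc) (b<x ∘ Fin.suc) rest-same i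

evalℕ-bound : ∀ {d q} .{{_ : NonZero q}} (a : Fin d → ℕ) → (∀ i → a i < q) → ∀ x → evalℕ a x < q * suc x ^ d
evalℕ-bound {zero} {q} a a<q x = subst (0 <_) (sym (*-identityʳ q)) (>-nonZero⁻¹ q)
evalℕ-bound {suc d} {q} a a<q x = begin-strict
  a Fin.zero + evalℕ (a ∘ Fin.suc) x * x
    <⟨ +-mono-<-≤ (<-≤-trans (a<q Fin.zero) (m≤m*n q S {{m^n≢0 (suc x) d}}))
                  (*-monoˡ-≤ x (<⇒≤ (evalℕ-bound (a ∘ Fin.suc) (a<q ∘ Fin.suc) x))) ⟩
  q * S + q * S * x   ≡⟨ cong (q * S +_) (*-comm (q * S) x) ⟩
  suc x * (q * S)     ≡⟨ *-assoc (suc x) q S ⟨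
  suc x * q * S       ≡⟨ cong (_* S) (*-comm (suc x) q) ⟩
  q * suc x * S       ≡⟨ *-assoc q (suc x) S ⟩
  q * suc x ^ suc d   ∎
  where
  open ≤-Reasoning
  S : ℕ
  S = suc x ^ d

funToFin-cong : ∀ {m n} {f g : Fin m → Fin n} → (∀ i → f i ≡ g i) → funToFin f ≡ funToFin g
funToFin-cong {zero} _ = refl
funToFin-cong {suc m} same = cong₂ Fin.combine (same Fin.zero) (funToFin-cong (same ∘ Fin.suc))

quotient-remainder-injective : ∀ {B} .{{_ : NonZero B}} ρ ρ′ → ρ / B ≡ ρ′ / B → ρ % B ≡ ρ′ % B → ρ ≡ ρ′
quotient-remainder-injective {B} ρ ρ′ same-quotient same-remainder = begin
  ρ                  ≡⟨ m≡m%n+[m/n]*n ρ B ⟩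
  ρ % B + ρ / B * B   ≡⟨ cong₂ (λ s t → s + t * B) same-remainder same-quotient ⟩
  ρ′ % B + ρ′ / B * B ≡⟨ m≡m%n+[m/n]*n ρ′ B ⟨
  ρ′                 ∎
  where open ≡-Reasoning

block-offset : ∀ {B} .{{_ : NonZero B}} {v} x → v < B → (v + x * B) / B ≡ x × (v + x * B) % B ≡ v
block-offset {B} {v} x v<B =
  let offset , block = divmod-unique (m%n<n (v + x * B) B) v<B (sym (m≡m%n+[m/n]*n (v + x * B) B))
  in block , offset

module PolynomialCode (r k q : ℕ) .{{q≢0 : NonZero q}} .{{k≢0 : NonZero k}} where

  -- Column j is the polynomial whose coefficients are the base-q digits of j.
  coefficients : Fin (q ^ r) → Fin r → ℕ
  coefficients j i = toℕ (finToFun j i)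

  coefficients-injective : ∀ {j j′} → (∀ i → coefficients j i ≡ coefficients j′ i) → j ≡ j′
  coefficients-injective {j} {j′} same = begin
    j                             ≡⟨ FinP.funToFin-finToFin {r} {q} j ⟨
    funToFin (finToFun {q} {r} j)  ≡⟨ funToFin-cong (λ i → FinP.toℕ-injective (same i)) ⟩
    funToFin (finToFun {q} {r} j′) ≡⟨ FinP.funToFin-finToFin {r} {q} j′ ⟩
    j′                            ∎
    where open ≡-Reasoning

  -- The block size: every column polynomial stays below B on 0, …, k−1.
  B : ℕ
  B = q * k ^ r

  instance
    B≢0 : NonZero B
    B≢0 = m*n≢0 q (k ^ r) {{q≢0}} {{m^n≢0 k r}}

  offset< : ∀ j x → x < k → evalℕ (coefficients j) x < B
  offset< j x x<k = <-≤-trans (evalℕ-bound (coefficients j) (λ i → FinP.toℕ<n (finToFun j i)) x)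
                              (*-monoʳ-≤ q (^-monoˡ-≤ r x<k))

  code : (m : ℕ) → Matrix m (q ^ r)
  code m ρ j = does (toℕ ρ % B ≟ evalℕ (coefficients j) (toℕ ρ / B))

  -- Two columns sharing r one-rows agree at the r distinct blocks of those
  -- rows, hence are the same polynomial and the same column.
  code-avoids : ∀ m → Avoids (code m) (allOnes r 2)
  code-avoids m (f , g , f↑ , g↑ , ones) =
    FinP.<-irrefl (coefficients-injective same-digits) (g↑ Fin.zero (Fin.suc Fin.zero) (s≤s z≤n))
    where
    block : Fin r → ℕ
    block i = toℕ (f i) / B
    on-column : ∀ c i → toℕ (f i) % B ≡ evalℕ (coefficients (g c)) (block i)
    on-column c i = does-true (toℕ (f i) % B ≟ evalℕ (coefficients (g c)) (block i)) (ones i c refl)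
    block-injective : Injective _≡_ _≡_ block
    block-injective {i} {i′} same = increasing-injective f↑ (FinP.toℕ-injective
      (quotient-remainder-injective {B} (toℕ (f i)) (toℕ (f i′)) same
        (trans (on-column Fin.zero i)
          (trans (cong (evalℕ (coefficients (g Fin.zero))) same) (sym (on-column Fin.zero i′))))))
    agree : ∀ x → evalℕ (coefficients (g Fin.zero)) x ≡ evalℕ (coefficients (g (Fin.suc Fin.zero))) x
    agree = agree⇒equal _ _ block block-injective
      (λ i → trans (sym (on-column Fin.zero i)) (on-column (Fin.suc Fin.zero) i))
    same-digits : ∀ i → coefficients (g Fin.zero) i ≡ coefficients (g (Fin.suc Fin.zero)) i
    same-digits = digits-unique _ _ q (λ i → FinP.toℕ<n (finToFun _ i)) (λ i → FinP.toℕ<n (finToFun _ i)) (agree q)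

  code-column : ∀ m → k * B ≤ m → ∀ j → k ≤ onesInColumn (code m) j
  code-column m kB≤m j = injection⇒ones (code m) j row row-injective row-one
    where
    f : ℕ → ℕ
    f = evalℕ (coefficients j)
    position< : ∀ (x : Fin k) → f (toℕ x) + toℕ x * B < m
    position< x = <-≤-trans (+-monoˡ-< (toℕ x * B) (offset< j (toℕ x) (FinP.toℕ<n x)))
                            (≤-trans (*-monoˡ-≤ B (FinP.toℕ<n x)) kB≤m)
    row : Fin k → Fin m
    row x = fromℕ< (position< x)
    decode : ∀ x → toℕ (row x) / B ≡ toℕ x × toℕ (row x) % B ≡ f (toℕ x)
    decode x rewrite FinP.toℕ-fromℕ< (position< x) = block-offset (toℕ x) (offset< j (toℕ x) (FinP.toℕ<n x))
    row-injective : Injective _≡_ _≡_ row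
    row-injective {x} {y} same = FinP.toℕ-injective
      (trans (sym (proj₁ (decode x))) (trans (cong (λ ρ → toℕ ρ / B) same) (proj₁ (decode y))))
    row-one : ∀ x → code m (row x) j ≡ true
    row-one x = dec-true (toℕ (row x) % B ≟ f (toℕ (row x) / B))
      (trans (proj₂ (decode x)) (cong f (sym (proj₁ (decode x)))))

^-distribʳ-* : ∀ x y r → (x * y) ^ r ≡ x ^ r * y ^ r
^-distribʳ-* x y zero = refl
^-distribʳ-* x y (suc r) = begin
  x * y * (x * y) ^ r        ≡⟨ cong (x * y *_) (^-distribʳ-* x y r) ⟩
  x * y * (x ^ r * y ^ r)    ≡⟨ *-assoc x y (x ^ r * y ^ r) ⟩
  x * (y * (x ^ r * y ^ r))  ≡⟨ cong (x *_) (x∙yz≈y∙xz y (x ^ r) (y ^ r)) ⟩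
  x * (x ^ r * (y * y ^ r))  ≡⟨ *-assoc x (x ^ r) (y * y ^ r) ⟨
  x ^ suc r * y ^ suc r      ∎
  where open ≡-Reasoning

lower-bound : ∀ {r c} k .{{_ : NonZero k}} (P : Matrix r c) → Contains P (allOnes r 2) →
  ∀ m → k ^ suc r ≤ m → Σ ℕ λ n → Σ (Matrix m n) λ A → Admissible k P A × m ^ r ≤ n * (k ^ suc r + k ^ suc r) ^ r
lower-bound {r} k P P⊇P₂ m Q≤m = q ^ r , code m , (avoids , code-column m kB≤m) , size
  where
  Q : ℕ
  Q = k ^ suc r
  instance
    Q≢0 : NonZero Q
    Q≢0 = m^n≢0 k (suc r)
  q : ℕ
  q = m / Q
  instance
    q≢0 : NonZero q
    q≢0 = >-nonZero (m≥n⇒m/n>0 Q≤m)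
  open PolynomialCode r k q
  avoids : Avoids (code m) P
  avoids code⊇P = code-avoids m (contains-trans {A = code m} code⊇P P⊇P₂)
  kB≤m : k * B ≤ m
  kB≤m = subst (_≤ m) (x∙yz≈y∙xz q k (k ^ r)) (m/n*n≤m m Q)
  m≤q[Q+Q] : m ≤ q * (Q + Q)
  m≤q[Q+Q] = begin
    m               ≡⟨ m≡m%n+[m/n]*n m Q ⟩
    m % Q + q * Q    ≤⟨ +-monoˡ-≤ (q * Q) (≤-trans (m%n≤n m Q) (m≤n*m Q q)) ⟩
    q * Q + q * Q    ≡⟨ *-distribˡ-+ q Q Q ⟨
    q * (Q + Q)      ∎
    where open ≤-Reasoning
  size : m ^ r ≤ q ^ r * (Q + Q) ^ r
  size = subst (m ^ r ≤_) (^-distribʳ-* q (Q + Q) r) (^-monoˡ-≤ r m≤q[Q+Q])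

mainTheorem7 : (r c : ℕ) → 1 ≤ r → (P : Matrix r c) → Contains P (allOnes r 2) →
    (k : ℕ) → r ≤ k → ExTheta k P
mainTheorem7 r zero _ P (_ , g , _) k _ with g Fin.zero
... | ()
mainTheorem7 r (suc t) 1≤r P P⊇P₂ k r≤k =
  (Q + Q) ^ r , suc t , Q , m^n>0 (Q + Q) r , s≤s z≤n ,
  λ m Q≤m → lower-bound k P P⊇P₂ m Q≤m ,
            λ n A admissible → ≤-trans (upper-bound k P A r≤k admissible) (m≤n+m (t * m ^ r) (m ^ r))
  where
  instance
    k≢0 : NonZero k
    k≢0 = >-nonZero (≤-trans 1≤r r≤k)
  Q : ℕ
  Q = k ^ suc r
  instance
    Q+Q≢0 : NonZero (Q + Q)
    Q+Q≢0 = >-nonZero (≤-trans (m^n>0 k (suc r)) (m≤m+n Q Q))
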